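{- Let $m\ge0$ and $0\le k\le m+2$ be integers. Among all rational numbers $n/F^m$ with $n\in\mathbb Z$, the one closest to $\varphi^{ -k}$ is $F^{m-k}/F^m$, and \[\left|\frac{F^{m-k}}{F^m}-\frac1{\varphi^k}\right|=\frac{1}{\varphi^{m+2}}\frac{F^{k-2}}{F^m}.\]
   Context: $\varphi=(1+\sqrt5)/2$; $F_0=0$, $F_1=1$, $F_k=F_{k-1}+F_{k-2}$ are the Fibonacci numbers, and $F^m:=F_{m+2}$ for integers $m\ge-2$ (so $F^{ -2}=0$, $F^{ -1}=F^0=1$). -}

module Defs where

open import Data.Bool using (Bool; true; false; _∧_; _∨_; not; T; if_then_else_)
open import Data.Nat as ℕ using (ℕ; zero; suc)
import Data.Nat.Properties as ℕP
open import Data.Integer as ℤ using (ℤ; ∣_∣)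
open import Data.Rational as ℚ using (ℚ; 0ℚ; 1ℚ)
open import Data.Rational.Properties as ℚP using ()
open import Relation.Nullary using (does)

fib : ℕ → ℕ
fib zero = zero
fib (suc zero) = suc zero
fib (suc (suc k)) = fib (suc k) ℕ.+ fib k

-- Shifted Fibonacci numbers F^j := F_{j+2}, meaningful for integers j ≥ -2
-- (so F^{-2} = 0, F^{-1} = F^0 = 1).  For j < -2 the value is junk and is
-- never used.
Fsup : ℤ → ℕ
Fsup j = fib ∣ j ℤ.+ ℤ.+ 2 ∣

fib-suc-pos : ∀ k → 0 ℕ.< fib (suc k)
fib-suc-pos zero = ℕ.s≤s ℕ.z≤n
fib-suc-pos (suc k) = ℕP.<-≤-trans (fib-suc-pos k) (ℕP.m≤m+n (fib (suc k)) (fib k))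

Fsup-nonZero : ∀ (m : ℕ) → ℕ.NonZero (fib (suc (suc m)))
Fsup-nonZero m = ℕ.>-nonZero (fib-suc-pos (suc m))

_/F^_ : ℤ → ℕ → ℚ
n /F^ m = ℚ._/_ n (fib (suc (suc m))) {{Fsup-nonZero m}}

-- The real quadratic field ℚ(φ) = ℚ(√5) ⊂ ℝ, φ = (1+√5)/2.
-- An element  a + b φ  (a b : ℚ).  Since 1, φ are ℚ-linearly independent,
-- propositional equality of records is equality of real numbers.

record Qφ : Set where
  constructor _+_φ
  field
    a : ℚ
    b : ℚ
open Qφ public

infixl 6 _⊕_ _⊖_
infixl 7 _⊗_

embed : ℚ → Qφ
embed q = q + 0ℚ φ

φ : Qφ
φ = 0ℚ + 1ℚ φ

_⊕_ : Qφ → Qφ → Qφ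
x ⊕ y = (a x ℚ.+ a y) + (b x ℚ.+ b y) φ

neg : Qφ → Qφ
neg x = (ℚ.- a x) + (ℚ.- b x) φ

_⊖_ : Qφ → Qφ → Qφ
x ⊖ y = x ⊕ neg y

-- (a + bφ)(c + dφ) = (ac + bd) + (ad + bc + bd)φ,   using φ² = φ + 1
_⊗_ : Qφ → Qφ → Qφ
x ⊗ y = (a x ℚ.* a y ℚ.+ b x ℚ.* b y)
      + (a x ℚ.* b y ℚ.+ b x ℚ.* a y ℚ.+ b x ℚ.* b y) φ

_^_ : Qφ → ℕ → Qφ
x ^ zero = embed 1ℚ
x ^ suc n = x ⊗ (x ^ n)

-- φ⁻¹ = φ - 1  (indeed φ(φ - 1) = φ² - φ = 1)
φ⁻¹ : Qφ
φ⁻¹ = (ℚ.- 1ℚ) + 1ℚ φ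

φ^-_ : ℕ → Qφ
φ^- k = φ⁻¹ ^ k

-- The order inherited from ℝ.
-- a + bφ = (x + y√5)/2 with x = 2a + b, y = b.

private
  _≤ᵇ_ _<ᵇ_ : ℚ → ℚ → Bool
  p ≤ᵇ q = does (p ℚP.≤? q)
  p <ᵇ q = does (p ℚP.<? q)

  five : ℚ
  five = ℤ.+ 5 ℚ./ 1

isPos√5 : ℚ → ℚ → Bool
isPos√5 x y =
     (0ℚ ≤ᵇ x ∧ 0ℚ ≤ᵇ y ∧ (0ℚ <ᵇ x ∨ 0ℚ <ᵇ y))
  ∨ (0ℚ ≤ᵇ x ∧ y <ᵇ 0ℚ ∧ (five ℚ.* (y ℚ.* y)) <ᵇ (x ℚ.* x))
  ∨ (x <ᵇ 0ℚ ∧ 0ℚ <ᵇ y ∧ (x ℚ.* x) <ᵇ (five ℚ.* (y ℚ.* y)))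

isPos : Qφ → Bool
isPos z = isPos√5 ((ℤ.+ 2 ℚ./ 1) ℚ.* a z ℚ.+ b z) (b z)

infix 4 _<φ_

_<φ_ : Qφ → Qφ → Set
x <φ y = T (isPos (y ⊖ x))

∣_∣φ : Qφ → Qφ
∣ x ∣φ = if isPos x then x else neg x

-- Let N = m + 2 and F = F_N.  The errors n/F - φ⁻ᵏ all lie in the lattice (ℤ + ℤφ)/F.
-- Since φ⁻ᵏ = (-1)ᵏ (F_{k+1} - F_k φ), d'Ocagne's identity F_N F_{k+1} - F_{N+1} F_k = (-1)ᵏ F_{N-k}
-- shows that the error at n = F_{N-k} is ±ρ with ρ = φ⁻ᴺ F_k / F, and the error at any other n is
-- J/F ± ρ with J a nonzero integer; so both claims follow from 0 ≤ ρ < 1/(2F).  Whether x + y√5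
-- (x, y ∈ ℤ) is positive is decided by the signs of x, y and of the norm x² - 5y².  Here
-- 2φ⁻ᴺ = (-1)ᴺ (L_N - F_N √5) has norm 4(-1)ᴺ by Lucas' identity, which turns both bounds on ρ
-- into polynomial inequalities whose slack is visibly positive once 2F_k ≤ L_N.
module Submission where

open import Defs
open import Algebra.Bundles using (CommutativeMonoid)
open import Data.Bool using (T; true; false)
open import Data.Empty using (⊥-elim)
open import Data.List using (_∷_; [])
open import Data.Nat as ℕ using (ℕ; zero; suc; z≤n; s≤s)
import Data.Nat.Properties as ℕP
open import Data.Integer as ℤ using (ℤ; +_; -[1+_]; 0ℤ; 1ℤ; -1ℤ; +≤+; +<+; nonNegative)
import Data.Integer.Properties as ℤP
open import Data.Integer.Tactic.RingSolver
open import Data.Product using (_×_; _,_; proj₁; proj₂)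
open import Data.Rational as ℚ using (ℚ; 0ℚ; 1ℚ; _/_; toℚᵘ)
import Data.Rational.Properties as ℚP
open import Data.Rational.Unnormalised as ℚᵘ using (mkℚᵘ; *≡*; *≤*; *<*) renaming (_≃_ to _≃ᵘ_)
import Data.Rational.Unnormalised.Properties as ℚᵘP
open import Data.Sum as Sum using (_⊎_; inj₁; inj₂)
open import Function.Bundles using (_⇔_; mk⇔; Equivalence)
open import Function.Properties.Equivalence using () renaming (trans to ⇔-trans)
open import Relation.Binary.PropositionalEquality
open import Relation.Nullary using (¬_; Dec; yes; no; does)
open import Relation.Nullary.Decidable using (_×-dec_; _⊎-dec_)
open Equivalence

fib-≤-suc : ∀ n → fib n ℕ.≤ fib (suc n)
fib-≤-suc zero = z≤n
fib-≤-suc (suc n) = ℕP.m≤m+n (fib (suc n)) (fib n)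

fib-<-suc : ∀ {n} → n ≢ 1 → fib n ℕ.< fib (suc n)
fib-<-suc {zero} _ = s≤s z≤n
fib-<-suc {suc zero} n≢1 = ⊥-elim (n≢1 refl)
fib-<-suc {suc (suc n)} _ = ℕP.m<m+n (fib (suc (suc n))) (fib-suc-pos n)

fib-mono : ∀ {m n} → m ℕ.≤ n → fib m ℕ.≤ fib n
fib-mono {n = zero} m≤0 rewrite ℕP.n≤0⇒n≡0 m≤0 = ℕP.≤-refl
fib-mono {m} {suc n} m≤1+n with ℕP.m≤n⇒m<n∨m≡n m≤1+n
... | inj₁ m<1+n = ℕP.≤-trans (fib-mono (ℕ.s≤s⁻¹ m<1+n)) (fib-≤-suc n)
... | inj₂ refl = ℕP.≤-refl

sign : ℕ → ℤ
sign zero = 1ℤ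
sign (suc k) = ℤ.- sign k

f : ℕ → ℤ
f n = + fib n

module _ where
  open import Data.Integer using (-_; _+_; _-_; _*_)
  open ≡-Reasoning

  sign-±1 : ∀ k → sign k ≡ 1ℤ ⊎ sign k ≡ -1ℤ
  sign-±1 zero = inj₁ refl
  sign-±1 (suc k) = Sum.swap (Sum.map (cong (-_)) (cong (-_)) (sign-±1 k))

  sign-+ : ∀ j k → sign (j ℕ.+ k) ≡ sign j * sign k
  sign-+ zero k = sym (ℤP.*-identityˡ (sign k))
  sign-+ (suc j) k = trans (cong (-_) (sign-+ j k)) (ℤP.neg-distribˡ-* (sign j) (sign k))

  sign*sign : ∀ k → sign k * sign k ≡ 1ℤ
  sign*sign k with sign-±1 k
  ... | inj₁ e rewrite e = refl
  ... | inj₂ e rewrite e = refl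

  sign≡1⇒≢1 : ∀ {m} → sign m ≡ 1ℤ → m ≢ 1
  sign≡1⇒≢1 σ≡1 refl with σ≡1
  ... | ()

  d'Ocagne : ∀ k r → f (k ℕ.+ r) * f (suc k) - f (suc (k ℕ.+ r)) * f k ≡ sign k * f r
  d'Ocagne zero r = base (f r) (f (suc r))
    where
    base : ∀ x y → x * 1ℤ - y * 0ℤ ≡ 1ℤ * x
    base = solve-∀
  d'Ocagne (suc k) r = begin
    f (suc (k ℕ.+ r)) * (f (suc k) + f k) - (f (suc (k ℕ.+ r)) + f (k ℕ.+ r)) * f (suc k)
      ≡⟨ expand (f (suc (k ℕ.+ r))) (f (k ℕ.+ r)) (f (suc k)) (f k) ⟩
    - (f (k ℕ.+ r) * f (suc k) - f (suc (k ℕ.+ r)) * f k)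
      ≡⟨ cong (-_) (d'Ocagne k r) ⟩
    - (sign k * f r)
      ≡⟨ ℤP.neg-distribˡ-* (sign k) (f r) ⟩
    sign (suc k) * f r ∎
    where
    expand : ∀ x y c d → x * (c + d) - (x + y) * c ≡ - (y * c - x * d)
    expand = solve-∀

  cassini : ∀ m → f (suc m) * f (suc m) - f (suc (suc m)) * f m ≡ sign m
  cassini m = begin
    f (suc m) * f (suc m) - f (suc (suc m)) * f m
      ≡⟨ cong (λ j → f j * f (suc m) - f (suc j) * f m) (ℕP.+-comm 1 m) ⟩
    f (m ℕ.+ 1) * f (suc m) - f (suc (m ℕ.+ 1)) * f m
      ≡⟨ d'Ocagne m 1 ⟩
    sign m * 1ℤ
      ≡⟨ ℤP.*-identityʳ (sign m) ⟩
    sign m ∎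

  -- L_{m+2} = F_{m+2} + 2 F_{m+1}
  lucas : ∀ m → (f (suc (suc m)) + + 2 * f (suc m)) * (f (suc (suc m)) + + 2 * f (suc m))
                ≡ + 5 * (f (suc (suc m)) * f (suc (suc m))) + + 4 * sign (suc (suc m))
  lucas m = begin
    (f (suc (suc m)) + + 2 * f (suc m)) * (f (suc (suc m)) + + 2 * f (suc m))
      ≡⟨ norm-identity (f (suc m)) (f m) ⟩
    + 5 * (f (suc (suc m)) * f (suc (suc m))) + + 4 * (f (suc m) * f (suc m) - f (suc (suc m)) * f m)
      ≡⟨ cong (λ c → + 5 * (f (suc (suc m)) * f (suc (suc m))) + + 4 * c)
              (trans (cassini m) (sym (ℤP.neg-involutive (sign m)))) ⟩
    + 5 * (f (suc (suc m)) * f (suc (suc m))) + + 4 * sign (suc (suc m)) ∎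
    where
    norm-identity : ∀ x y → (x + y + + 2 * x) * (x + y + + 2 * x)
                            ≡ + 5 * ((x + y) * (x + y)) + + 4 * (x * x - (x + y) * y)
    norm-identity = solve-∀

ι : ℤ → ℚ
ι i = i / 1

module _ where
  open ℚᵘP.≃-Reasoning

  toℚᵘ-ι : ∀ i → toℚᵘ (ι i) ≃ᵘ mkℚᵘ i 0
  toℚᵘ-ι i = ℚP.toℚᵘ-fromℚᵘ (mkℚᵘ i 0)

  private
    ι≡ : ∀ {i q} → mkℚᵘ i 0 ≃ᵘ toℚᵘ q → ι i ≡ q
    ι≡ {i} e = ℚP.toℚᵘ-injective (ℚᵘP.≃-trans (toℚᵘ-ι i) e)

  ι-+ : ∀ i j → ι (i ℤ.+ j) ≡ ι i ℚ.+ ι j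
  ι-+ i j = ι≡ (begin
    mkℚᵘ (i ℤ.+ j) 0               ≈⟨ *≡* (numerators i j) ⟩
    mkℚᵘ i 0 ℚᵘ.+ mkℚᵘ j 0         ≈⟨ ℚᵘP.+-cong (toℚᵘ-ι i) (toℚᵘ-ι j) ⟨
    toℚᵘ (ι i) ℚᵘ.+ toℚᵘ (ι j)     ≈⟨ ℚP.toℚᵘ-homo-+ (ι i) (ι j) ⟨
    toℚᵘ (ι i ℚ.+ ι j)             ∎)
    where
    numerators : ∀ i j → (i ℤ.+ j) ℤ.* + 1 ≡ (i ℤ.* + 1 ℤ.+ j ℤ.* + 1) ℤ.* + 1
    numerators = solve-∀

  ι-* : ∀ i j → ι (i ℤ.* j) ≡ ι i ℚ.* ι j
  ι-* i j = ι≡ (begin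
    mkℚᵘ (i ℤ.* j) 0               ≈⟨ ℚᵘP.≃-refl ⟩
    mkℚᵘ i 0 ℚᵘ.* mkℚᵘ j 0         ≈⟨ ℚᵘP.*-cong (toℚᵘ-ι i) (toℚᵘ-ι j) ⟨
    toℚᵘ (ι i) ℚᵘ.* toℚᵘ (ι j)     ≈⟨ ℚP.toℚᵘ-homo-* (ι i) (ι j) ⟨
    toℚᵘ (ι i ℚ.* ι j)             ∎)

  ι-neg : ∀ i → ι (ℤ.- i) ≡ ℚ.- ι i
  ι-neg i = ι≡ (begin
    mkℚᵘ (ℤ.- i) 0                 ≈⟨ ℚᵘP.-‿cong (toℚᵘ-ι i) ⟨
    ℚᵘ.- toℚᵘ (ι i)                ≈⟨ ℚP.toℚᵘ-homo‿- (ι i) ⟨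
    toℚᵘ (ℚ.- ι i)                 ∎)

  ι-≤ : ∀ {i j} → ι i ℚ.≤ ι j ⇔ i ℤ.≤ j
  ι-≤ {i} {j} = mk⇔
    (λ p → subst₂ ℤ._≤_ (ℤP.*-identityʳ i) (ℤP.*-identityʳ j)
       (ℚᵘP.drop-*≤* (ℚᵘP.≤-respˡ-≃ (toℚᵘ-ι i) (ℚᵘP.≤-respʳ-≃ (toℚᵘ-ι j) (ℚP.toℚᵘ-mono-≤ p)))))
    (λ p → ℚP.toℚᵘ-cancel-≤ (ℚᵘP.≤-respˡ-≃ (ℚᵘP.≃-sym (toℚᵘ-ι i)) (ℚᵘP.≤-respʳ-≃ (ℚᵘP.≃-sym (toℚᵘ-ι j))
       (*≤* (subst₂ ℤ._≤_ (sym (ℤP.*-identityʳ i)) (sym (ℤP.*-identityʳ j)) p)))))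

  ι-< : ∀ {i j} → ι i ℚ.< ι j ⇔ i ℤ.< j
  ι-< {i} {j} = mk⇔
    (λ p → subst₂ ℤ._<_ (ℤP.*-identityʳ i) (ℤP.*-identityʳ j)
       (ℚᵘP.drop-*<* (ℚᵘP.<-respˡ-≃ (toℚᵘ-ι i) (ℚᵘP.<-respʳ-≃ (toℚᵘ-ι j) (ℚP.toℚᵘ-mono-< p)))))
    (λ p → ℚP.toℚᵘ-cancel-< (ℚᵘP.<-respˡ-≃ (ℚᵘP.≃-sym (toℚᵘ-ι i)) (ℚᵘP.<-respʳ-≃ (ℚᵘP.≃-sym (toℚᵘ-ι j))
       (*<* (subst₂ ℤ._<_ (sym (ℤP.*-identityʳ i)) (sym (ℤP.*-identityʳ j)) p)))))

  /-ι : ∀ i n .{{_ : ℕ.NonZero n}} → i / n ≡ ι i ℚ.* (+ 1 / n)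
  /-ι i (suc d) = ℚP.toℚᵘ-injective (begin
    toℚᵘ (i / suc d)                    ≈⟨ ℚP.toℚᵘ-fromℚᵘ (mkℚᵘ i d) ⟩
    mkℚᵘ i d                            ≈⟨ *≡* (cong₂ ℤ._*_ (sym (ℤP.*-identityʳ i))
                                                         (cong (λ x → + suc x) (ℕP.+-identityʳ d))) ⟩
    mkℚᵘ i 0 ℚᵘ.* mkℚᵘ (+ 1) d          ≈⟨ ℚᵘP.*-cong (toℚᵘ-ι i) (ℚP.toℚᵘ-fromℚᵘ (mkℚᵘ (+ 1) d)) ⟨
    toℚᵘ (ι i) ℚᵘ.* toℚᵘ (+ 1 / suc d)  ≈⟨ ℚP.toℚᵘ-homo-* (ι i) (+ 1 / suc d) ⟨
    toℚᵘ (ι i ℚ.* (+ 1 / suc d))        ∎)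

  ι*1/n≡1 : ∀ n .{{_ : ℕ.NonZero n}} → ι (+ n) ℚ.* (+ 1 / n) ≡ 1ℚ
  ι*1/n≡1 (suc d) = ℚP.toℚᵘ-injective (begin
    toℚᵘ (ι (+ suc d) ℚ.* (+ 1 / suc d))        ≈⟨ ℚP.toℚᵘ-homo-* (ι (+ suc d)) (+ 1 / suc d) ⟩
    toℚᵘ (ι (+ suc d)) ℚᵘ.* toℚᵘ (+ 1 / suc d)  ≈⟨ ℚᵘP.*-cong (toℚᵘ-ι (+ suc d)) (ℚP.toℚᵘ-fromℚᵘ (mkℚᵘ (+ 1) d)) ⟩
    mkℚᵘ (+ suc d) 0 ℚᵘ.* mkℚᵘ (+ 1) d          ≈⟨ *≡* (trans (ℤP.*-identityʳ _) (trans (ℤP.*-identityʳ _)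
                                                     (trans (cong (λ x → + suc x) (sym (ℕP.+-identityʳ d)))
                                                            (sym (ℤP.*-identityˡ _))))) ⟩
    mkℚᵘ (+ 1) 0                                ∎)

-- Positivity of x + y√5 for integers x, y

module _ where
  open import Data.Integer using (-_; _+_; _-_; _*_; _≤_; _<_; _≤?_)
  open import Data.Integer.Properties using
    (≤-trans; <-≤-trans; ≤-<-trans; <⇒≤; ≰⇒>; <⇒≱; <-asym; ≤-antisym; neg-mono-≤; neg-cancel-≤; neg-cancel-<;
     *-monoˡ-≤-nonNeg; *-monoʳ-≤-nonNeg; i≤i+j)

  0<+suc : ∀ {n} → 0ℤ < + suc n
  0<+suc = +<+ (s≤s z≤n)

  0≤-* : ∀ {i j} → 0ℤ ≤ i → 0ℤ ≤ j → 0ℤ ≤ i * j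
  0≤-* {+ n} {+ m} _ _ = subst (0ℤ ≤_) (ℤP.pos-* n m) (+≤+ z≤n)

  0<-* : ∀ {i j} → 0ℤ < i → 0ℤ < j → 0ℤ < i * j
  0<-* {i} {j} 0<i 0<j = subst (_< i * j) (ℤP.*-zeroʳ i) (ℤP.*-monoˡ-<-pos i {{ℤ.positive 0<i}} 0<j)

  0<-+ : ∀ {i j} → 0ℤ < i → 0ℤ ≤ j → 0ℤ < i + j
  0<-+ {i} {j} 0<i 0≤j = <-≤-trans 0<i (i≤i+j i j {{nonNegative 0≤j}})

  <-by-slack : ∀ {x y d} → 0ℤ < d → y ≡ x + d → x < y
  <-by-slack {x} {d = d} 0<d refl = subst (_< x + d) (ℤP.+-identityʳ x) (ℤP.+-monoʳ-< x 0<d)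

  ≤-by-slack : ∀ {x y d} → 0ℤ ≤ d → y ≡ x + d → x ≤ y
  ≤-by-slack {x} {d = d} 0≤d refl = i≤i+j x d {{nonNegative 0≤d}}

  neg-square : ∀ i → - i * - i ≡ i * i
  neg-square = solve-∀

  0≤-square : ∀ i → 0ℤ ≤ i * i
  0≤-square i with 0ℤ ≤? i
  ... | yes 0≤i = 0≤-* 0≤i 0≤i
  ... | no  0≰i = subst (0ℤ ≤_) (neg-square i) (0≤-* 0≤-i 0≤-i)
    where
    0≤-i : 0ℤ ≤ - i
    0≤-i = neg-mono-≤ (<⇒≤ (≰⇒> 0≰i))

  square-mono : ∀ {i j} → 0ℤ ≤ i → i ≤ j → i * i ≤ j * j
  square-mono {i} {j} 0≤i i≤j = ≤-trans (*-monoˡ-≤-nonNeg i {{nonNegative 0≤i}} i≤j)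
                                        (*-monoʳ-≤-nonNeg j {{nonNegative (≤-trans 0≤i i≤j)}} i≤j)

  0≤-i⇒i≤0 : ∀ {i} → 0ℤ ≤ - i → i ≤ 0ℤ
  0≤-i⇒i≤0 {i} = neg-cancel-≤ {0ℤ} {i}

  0<-i⇒i<0 : ∀ {i} → 0ℤ < - i → i < 0ℤ
  0<-i⇒i<0 {i} = neg-cancel-< {0ℤ} {i}

  -i<0⇒0<i : ∀ {i} → - i < 0ℤ → 0ℤ < i
  -i<0⇒0<i {i} = neg-cancel-< {i} {0ℤ}

  data Pos√5 (x y : ℤ) : Set where
    nonneg-parts : 0ℤ ≤ x → 0ℤ ≤ y → 0ℤ < x ⊎ 0ℤ < y → Pos√5 x y
    rational-part-dominates : 0ℤ ≤ x → y < 0ℤ → + 5 * (y * y) < x * x → Pos√5 x y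
    irrational-part-dominates : x < 0ℤ → 0ℤ < y → x * x < + 5 * (y * y) → Pos√5 x y

  Pos√5-2 : Pos√5 (+ 2) 0ℤ
  Pos√5-2 = nonneg-parts (+≤+ z≤n) (+≤+ z≤n) (inj₁ 0<+suc)

  ¬Pos√5-0 : ¬ Pos√5 0ℤ 0ℤ
  ¬Pos√5-0 (nonneg-parts _ _ (inj₁ (+<+ ())))
  ¬Pos√5-0 (nonneg-parts _ _ (inj₂ (+<+ ())))
  ¬Pos√5-0 (rational-part-dominates _ (+<+ ()) _)
  ¬Pos√5-0 (irrational-part-dominates (+<+ ()) _ _)

  Pos√5-norm>0 : ∀ {x y} → 0ℤ < x → + 5 * (y * y) < x * x → Pos√5 x y
  Pos√5-norm>0 {y = y} 0<x norm>0 with 0ℤ ≤? y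
  ... | yes 0≤y = nonneg-parts (<⇒≤ 0<x) 0≤y (inj₁ 0<x)
  ... | no  0≰y = rational-part-dominates (<⇒≤ 0<x) (≰⇒> 0≰y) norm>0

  Pos√5-norm<0 : ∀ {x y} → 0ℤ < y → x * x < + 5 * (y * y) → Pos√5 x y
  Pos√5-norm<0 {x} 0<y norm<0 with 0ℤ ≤? x
  ... | yes 0≤x = nonneg-parts 0≤x (<⇒≤ 0<y) (inj₂ 0<y)
  ... | no  0≰x = irrational-part-dominates (≰⇒> 0≰x) 0<y norm<0

  Pos√5-monoˡ : ∀ {x x' y} → x ≤ x' → Pos√5 x y → Pos√5 x' y
  Pos√5-monoˡ x≤x' (nonneg-parts 0≤x 0≤y 0<x⊎0<y) =
    nonneg-parts (≤-trans 0≤x x≤x') 0≤y (Sum.map₁ (λ 0<x → <-≤-trans 0<x x≤x') 0<x⊎0<y)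
  Pos√5-monoˡ x≤x' (rational-part-dominates 0≤x y<0 norm>0) =
    rational-part-dominates (≤-trans 0≤x x≤x') y<0 (<-≤-trans norm>0 (square-mono 0≤x x≤x'))
  Pos√5-monoˡ {x} {x'} x≤x' (irrational-part-dominates x<0 0<y norm<0) with 0ℤ ≤? x'
  ... | yes 0≤x' = nonneg-parts 0≤x' (<⇒≤ 0<y) (inj₂ 0<y)
  ... | no  0≰x' = irrational-part-dominates x'<0 0<y (≤-<-trans x'²≤x² norm<0)
    where
    x'<0 : x' < 0ℤ
    x'<0 = ≰⇒> 0≰x'
    x'²≤x² : x' * x' ≤ x * x
    x'²≤x² = subst₂ _≤_ (neg-square x') (neg-square x)
               (square-mono (neg-mono-≤ (<⇒≤ x'<0)) (neg-mono-≤ x≤x'))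

  Pos√5-shift : ∀ {x x' y y'} → Pos√5 x y → ∀ d → 0ℤ ≤ d → x' ≡ x + d → y' ≡ y → Pos√5 x' y'
  Pos√5-shift {x} pos d 0≤d refl refl = Pos√5-monoˡ (i≤i+j x d {{nonNegative 0≤d}}) pos

  module _ {c : ℤ} (0<c : 0ℤ < c) where
    private
      instance
        c-pos : ℤ.Positive c
        c-pos = ℤ.positive 0<c
        c-nonneg : ℤ.NonNegative c
        c-nonneg = nonNegative (<⇒≤ 0<c)

      0≤-cancel : ∀ {i} → 0ℤ ≤ c * i → 0ℤ ≤ i
      0≤-cancel {i} 0≤ci = ℤP.*-cancelˡ-≤-pos 0ℤ i c (subst (_≤ c * i) (sym (ℤP.*-zeroʳ c)) 0≤ci)

      0<-cancel : ∀ {i} → 0ℤ < c * i → 0ℤ < i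
      0<-cancel {i} 0<ci = ℤP.*-cancelˡ-<-nonNeg c (subst (_< c * i) (sym (ℤP.*-zeroʳ c)) 0<ci)

      <0-cancel : ∀ {i} → c * i < 0ℤ → i < 0ℤ
      <0-cancel {i} ci<0 = ℤP.*-cancelˡ-<-nonNeg c (subst (c * i <_) (sym (ℤP.*-zeroʳ c)) ci<0)

      c²-cancel : ∀ {i j} → (c * c) * i < (c * c) * j → i < j
      c²-cancel = ℤP.*-cancelˡ-<-nonNeg (c * c) {{nonNegative (0≤-square c)}}

      square : ∀ i → (c * i) * (c * i) ≡ (c * c) * (i * i)
      square i = solve (c ∷ i ∷ [])

      five-square : ∀ i → + 5 * ((c * i) * (c * i)) ≡ (c * c) * (+ 5 * (i * i))
      five-square i = solve (c ∷ i ∷ [])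

    Pos√5-cancel : ∀ {x y} → Pos√5 (c * x) (c * y) → Pos√5 x y
    Pos√5-cancel (nonneg-parts 0≤cx 0≤cy 0<cx⊎0<cy) =
      nonneg-parts (0≤-cancel 0≤cx) (0≤-cancel 0≤cy) (Sum.map 0<-cancel 0<-cancel 0<cx⊎0<cy)
    Pos√5-cancel {x} {y} (rational-part-dominates 0≤cx cy<0 norm>0) =
      rational-part-dominates (0≤-cancel 0≤cx) (<0-cancel cy<0)
        (c²-cancel (subst₂ _<_ (five-square y) (square x) norm>0))
    Pos√5-cancel {x} {y} (irrational-part-dominates cx<0 0<cy norm<0) =
      irrational-part-dominates (<0-cancel cx<0) (0<-cancel 0<cy)
        (c²-cancel (subst₂ _<_ (square x) (five-square y) norm<0))

  Pos√5-asym : ∀ {x y} → Pos√5 x y → ¬ Pos√5 (- x) (- y)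
  Pos√5-asym (nonneg-parts _ _ (inj₁ 0<x)) (nonneg-parts 0≤-x _ _) = <⇒≱ 0<x (0≤-i⇒i≤0 0≤-x)
  Pos√5-asym (nonneg-parts _ _ (inj₂ 0<y)) (nonneg-parts _ 0≤-y _) = <⇒≱ 0<y (0≤-i⇒i≤0 0≤-y)
  Pos√5-asym {y = y} (nonneg-parts 0≤x _ _) (rational-part-dominates 0≤-x _ norm>0)
    with ≤-antisym (0≤-i⇒i≤0 0≤-x) 0≤x
  ... | refl = <⇒≱ norm>0 (0≤-* {+ 5} (+≤+ z≤n) (0≤-square (- y)))
  Pos√5-asym (nonneg-parts _ 0≤y _) (irrational-part-dominates _ 0<-y _) = <⇒≱ (0<-i⇒i<0 0<-y) 0≤y
  Pos√5-asym {y = y} (rational-part-dominates 0≤x _ norm>0) (nonneg-parts 0≤-x _ _)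
    with ≤-antisym (0≤-i⇒i≤0 0≤-x) 0≤x
  ... | refl = <⇒≱ norm>0 (0≤-* {+ 5} (+≤+ z≤n) (0≤-square y))
  Pos√5-asym (rational-part-dominates _ y<0 _) (rational-part-dominates _ -y<0 _) = <-asym y<0 (-i<0⇒0<i -y<0)
  Pos√5-asym {x} {y} (rational-part-dominates _ _ norm>0) (irrational-part-dominates _ _ norm<0) =
    <-asym norm>0 (subst₂ _<_ (neg-square x) (cong (+ 5 *_) (neg-square y)) norm<0)
  Pos√5-asym (irrational-part-dominates _ 0<y _) (nonneg-parts _ 0≤-y _) = <⇒≱ 0<y (0≤-i⇒i≤0 0≤-y)
  Pos√5-asym {x} {y} (irrational-part-dominates _ _ norm<0) (rational-part-dominates _ _ norm>0) =
    <-asym norm<0 (subst₂ _<_ (cong (+ 5 *_) (neg-square y)) (neg-square x) norm>0)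
  Pos√5-asym (irrational-part-dominates x<0 _ _) (irrational-part-dominates -x<0 _ _) = <-asym x<0 (-i<0⇒0<i -x<0)

T-does : ∀ {P : Set} (d : Dec P) → T (does d) ⇔ P
T-does (yes p) = mk⇔ (λ _ → p) (λ _ → _)
T-does (no ¬p) = mk⇔ (λ ()) ¬p

IsPos√5 : ℚ → ℚ → Set
IsPos√5 x y = (0ℚ ℚ.≤ x × 0ℚ ℚ.≤ y × (0ℚ ℚ.< x ⊎ 0ℚ ℚ.< y))
            ⊎ (0ℚ ℚ.≤ x × y ℚ.< 0ℚ × ι (+ 5) ℚ.* (y ℚ.* y) ℚ.< x ℚ.* x)
            ⊎ (x ℚ.< 0ℚ × 0ℚ ℚ.< y × x ℚ.* x ℚ.< ι (+ 5) ℚ.* (y ℚ.* y))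

-- does (isPos√5-dec x y) is isPos√5 x y by definition.
isPos√5-dec : ∀ x y → Dec (IsPos√5 x y)
isPos√5-dec x y =
        (0ℚ ℚP.≤? x ×-dec 0ℚ ℚP.≤? y ×-dec (0ℚ ℚP.<? x ⊎-dec 0ℚ ℚP.<? y))
  ⊎-dec (0ℚ ℚP.≤? x ×-dec y ℚP.<? 0ℚ ×-dec ι (+ 5) ℚ.* (y ℚ.* y) ℚP.<? x ℚ.* x)
  ⊎-dec (x ℚP.<? 0ℚ ×-dec 0ℚ ℚP.<? y ×-dec x ℚ.* x ℚP.<? ι (+ 5) ℚ.* (y ℚ.* y))

ι*-≤ : ∀ w .{{_ : ℚ.Positive w}} {i j} → ι i ℚ.* w ℚ.≤ ι j ℚ.* w ⇔ i ℤ.≤ j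
ι*-≤ w = mk⇔ (λ p → ι-≤ .to (ℚP.*-cancelʳ-≤-pos w p))
             (λ p → ℚP.*-monoʳ-≤-nonNeg w {{ℚP.pos⇒nonNeg w}} (ι-≤ .from p))

ι*-< : ∀ w .{{_ : ℚ.Positive w}} {i j} → ι i ℚ.* w ℚ.< ι j ℚ.* w ⇔ i ℤ.< j
ι*-< w = mk⇔ (λ p → ι-< .to (ℚP.*-cancelʳ-<-nonNeg w {{ℚP.pos⇒nonNeg w}} p))
             (λ p → ℚP.*-monoˡ-<-pos w (ι-< .from p))

module _ (w : ℚ) .{{_ : ℚ.Positive w}} where
  private
    instance
      w²-pos : ℚ.Positive (w ℚ.* w)
      w²-pos = ℚP.pos*pos⇒pos w w

    open import Algebra.Properties.CommutativeSemigroup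
      (CommutativeMonoid.commutativeSemigroup ℚP.*-1-commutativeMonoid) using (interchange)

    0≡ι0*w : 0ℚ ≡ ι 0ℤ ℚ.* w
    0≡ι0*w = sym (ℚP.*-zeroˡ w)

    square : ∀ i → (ι i ℚ.* w) ℚ.* (ι i ℚ.* w) ≡ ι (i ℤ.* i) ℚ.* (w ℚ.* w)
    square i = trans (interchange (ι i) w (ι i) w) (cong (ℚ._* (w ℚ.* w)) (sym (ι-* i i)))

    five-square : ∀ i → ι (+ 5) ℚ.* ((ι i ℚ.* w) ℚ.* (ι i ℚ.* w)) ≡ ι (+ 5 ℤ.* (i ℤ.* i)) ℚ.* (w ℚ.* w)
    five-square i = begin
      ι (+ 5) ℚ.* ((ι i ℚ.* w) ℚ.* (ι i ℚ.* w)) ≡⟨ cong (ι (+ 5) ℚ.*_) (square i) ⟩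
      ι (+ 5) ℚ.* (ι (i ℤ.* i) ℚ.* (w ℚ.* w))   ≡⟨ ℚP.*-assoc (ι (+ 5)) (ι (i ℤ.* i)) (w ℚ.* w) ⟨
      ι (+ 5) ℚ.* ι (i ℤ.* i) ℚ.* (w ℚ.* w)     ≡⟨ cong (ℚ._* (w ℚ.* w)) (ι-* (+ 5) (i ℤ.* i)) ⟨
      ι (+ 5 ℤ.* (i ℤ.* i)) ℚ.* (w ℚ.* w)       ∎
      where open ≡-Reasoning

    0≤-scaled : ∀ {x} → 0ℚ ℚ.≤ ι x ℚ.* w ⇔ 0ℤ ℤ.≤ x
    0≤-scaled {x} = mk⇔ (λ p → ι*-≤ w .to (subst (ℚ._≤ ι x ℚ.* w) 0≡ι0*w p))
                        (λ p → subst (ℚ._≤ ι x ℚ.* w) (sym 0≡ι0*w) (ι*-≤ w .from p))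

    0<-scaled : ∀ {x} → 0ℚ ℚ.< ι x ℚ.* w ⇔ 0ℤ ℤ.< x
    0<-scaled {x} = mk⇔ (λ p → ι*-< w .to (subst (ℚ._< ι x ℚ.* w) 0≡ι0*w p))
                        (λ p → subst (ℚ._< ι x ℚ.* w) (sym 0≡ι0*w) (ι*-< w .from p))

    <0-scaled : ∀ {x} → ι x ℚ.* w ℚ.< 0ℚ ⇔ x ℤ.< 0ℤ
    <0-scaled {x} = mk⇔ (λ p → ι*-< w .to (subst (ι x ℚ.* w ℚ.<_) 0≡ι0*w p))
                        (λ p → subst (ι x ℚ.* w ℚ.<_) (sym 0≡ι0*w) (ι*-< w .from p))

    norm>0-scaled : ∀ {x y} → ι (+ 5) ℚ.* ((ι y ℚ.* w) ℚ.* (ι y ℚ.* w)) ℚ.< (ι x ℚ.* w) ℚ.* (ι x ℚ.* w)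
                            ⇔ + 5 ℤ.* (y ℤ.* y) ℤ.< x ℤ.* x
    norm>0-scaled {x} {y} = mk⇔
      (λ p → ι*-< (w ℚ.* w) .to (subst₂ ℚ._<_ (five-square y) (square x) p))
      (λ p → subst₂ ℚ._<_ (sym (five-square y)) (sym (square x)) (ι*-< (w ℚ.* w) .from p))

    norm<0-scaled : ∀ {x y} → (ι x ℚ.* w) ℚ.* (ι x ℚ.* w) ℚ.< ι (+ 5) ℚ.* ((ι y ℚ.* w) ℚ.* (ι y ℚ.* w))
                            ⇔ x ℤ.* x ℤ.< + 5 ℤ.* (y ℤ.* y)
    norm<0-scaled {x} {y} = mk⇔
      (λ p → ι*-< (w ℚ.* w) .to (subst₂ ℚ._<_ (square x) (five-square y) p))
      (λ p → subst₂ ℚ._<_ (sym (square x)) (sym (five-square y)) (ι*-< (w ℚ.* w) .from p))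

  isPos√5-scaled : ∀ {x y} → T (isPos√5 (ι x ℚ.* w) (ι y ℚ.* w)) ⇔ Pos√5 x y
  isPos√5-scaled {x} {y} = ⇔-trans (T-does (isPos√5-dec (ι x ℚ.* w) (ι y ℚ.* w))) (mk⇔ to-Pos√5 from-Pos√5)
    where
    to-Pos√5 : IsPos√5 (ι x ℚ.* w) (ι y ℚ.* w) → Pos√5 x y
    to-Pos√5 (inj₁ (0≤x , 0≤y , 0<x⊎0<y)) =
      nonneg-parts (0≤-scaled {x} .to 0≤x) (0≤-scaled {y} .to 0≤y)
                   (Sum.map (0<-scaled {x} .to) (0<-scaled {y} .to) 0<x⊎0<y)
    to-Pos√5 (inj₂ (inj₁ (0≤x , y<0 , norm>0))) =
      rational-part-dominates (0≤-scaled {x} .to 0≤x) (<0-scaled {y} .to y<0) (norm>0-scaled {x} {y} .to norm>0)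
    to-Pos√5 (inj₂ (inj₂ (x<0 , 0<y , norm<0))) =
      irrational-part-dominates (<0-scaled {x} .to x<0) (0<-scaled {y} .to 0<y) (norm<0-scaled {x} {y} .to norm<0)

    from-Pos√5 : Pos√5 x y → IsPos√5 (ι x ℚ.* w) (ι y ℚ.* w)
    from-Pos√5 (nonneg-parts 0≤x 0≤y 0<x⊎0<y) =
      inj₁ (0≤-scaled {x} .from 0≤x , 0≤-scaled {y} .from 0≤y ,
            Sum.map (0<-scaled {x} .from) (0<-scaled {y} .from) 0<x⊎0<y)
    from-Pos√5 (rational-part-dominates 0≤x y<0 norm>0) =
      inj₂ (inj₁ (0≤-scaled {x} .from 0≤x , <0-scaled {y} .from y<0 , norm>0-scaled {x} {y} .from norm>0))
    from-Pos√5 (irrational-part-dominates x<0 0<y norm<0) =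
      inj₂ (inj₂ (<0-scaled {x} .from x<0 , 0<-scaled {y} .from 0<y , norm<0-scaled {x} {y} .from norm<0))

-- Bounds on ρ = φ⁻ᴺ G / F, where 2Fρ = σ G (L - F√5) with σ = (-1)ᴺ and L² = 5F² + 4σ:
-- ρ > 0 and 1/F - 2ρ > 0, in the coordinates x + y√5 of 2F times each side.

module _ {G F L : ℤ} (0<G : 0ℤ ℤ.< G) (0<F : 0ℤ ℤ.< F) where
  open import Data.Integer using (-_; _+_; _-_; _*_; _≤_; _<_)
  open ≡-Reasoning

  private
    0<GG : 0ℤ < G * G
    0<GG = 0<-* 0<G 0<G

    0<FG : 0ℤ < F * G
    0<FG = 0<-* 0<F 0<G

    0≤G-1 : 0ℤ ≤ G - 1ℤ
    0≤G-1 = ℤP.i≤j⇒0≤j-i (ℤP.i<j⇒suc[i]≤j 0<G)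

  ρ-bounds : ∀ {σ} → L * L ≡ + 5 * (F * F) + + 4 * σ →
             (σ ≡ 1ℤ × + 2 * G + 1ℤ ≤ L) ⊎ (σ ≡ -1ℤ × + 2 * G ≤ L) →
             Pos√5 (σ * (G * L)) (- (σ * (F * G)))
           × Pos√5 (+ 2 - + 2 * (σ * (G * L))) (+ 2 * (σ * (F * G)))
  ρ-bounds L²≡ (inj₁ (refl , 2G+1≤L)) =
      Pos√5-norm>0 (0<-* {1ℤ} 0<+suc 0<GL) (<-by-slack (0<-* {+ 4} 0<+suc 0<GG) ρ-norm)
    , Pos√5-norm<0 (0<-* {+ 2} 0<+suc (0<-* {1ℤ} 0<+suc 0<FG)) (<-by-slack (0<-* {+ 4} 0<+suc 0<1+s) half-norm)
    where
    0<GL : 0ℤ < G * L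
    0<GL = 0<-* 0<G (ℤP.<-≤-trans (0<-+ (0<-* {+ 2} 0<+suc 0<G) (+≤+ z≤n)) 2G+1≤L)

    0<1+s : 0ℤ < 1ℤ + (+ 2 * G * (L - (+ 2 * G + 1ℤ)) + + 2 * (G - 1ℤ))
    0<1+s = 0<-+ 0<+suc (ℤP.+-mono-≤ (0≤-* (0≤-* {+ 2} (+≤+ z≤n) (ℤP.<⇒≤ 0<G)) (ℤP.i≤j⇒0≤j-i 2G+1≤L))
                                (0≤-* {+ 2} (+≤+ z≤n) 0≤G-1))

    ρ-norm : (1ℤ * (G * L)) * (1ℤ * (G * L)) ≡ + 5 * (- (1ℤ * (F * G)) * - (1ℤ * (F * G))) + + 4 * (G * G)
    ρ-norm = begin
      (1ℤ * (G * L)) * (1ℤ * (G * L))                   ≡⟨ solve (G ∷ L ∷ []) ⟩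
      (G * G) * (L * L)                                 ≡⟨ cong ((G * G) *_) L²≡ ⟩
      (G * G) * (+ 5 * (F * F) + + 4 * 1ℤ)              ≡⟨ solve (G ∷ F ∷ []) ⟩
      + 5 * (- (1ℤ * (F * G)) * - (1ℤ * (F * G))) + + 4 * (G * G) ∎

    half-norm : + 5 * ((+ 2 * (1ℤ * (F * G))) * (+ 2 * (1ℤ * (F * G))))
              ≡ (+ 2 - + 2 * (1ℤ * (G * L))) * (+ 2 - + 2 * (1ℤ * (G * L)))
                + + 4 * (1ℤ + (+ 2 * G * (L - (+ 2 * G + 1ℤ)) + + 2 * (G - 1ℤ)))
    half-norm = begin
      + 5 * ((+ 2 * (1ℤ * (F * G))) * (+ 2 * (1ℤ * (F * G))))       ≡⟨ solve (F ∷ G ∷ []) ⟩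
      + 4 * (G * G) * (+ 5 * (F * F) + + 4 * 1ℤ) - + 16 * (G * G)     ≡⟨ cong (λ c → + 4 * (G * G) * c - + 16 * (G * G)) L²≡ ⟨
      + 4 * (G * G) * (L * L) - + 16 * (G * G)                        ≡⟨ solve (G ∷ L ∷ []) ⟩
      (+ 2 - + 2 * (1ℤ * (G * L))) * (+ 2 - + 2 * (1ℤ * (G * L))) + + 4 * (1ℤ + (+ 2 * G * (L - (+ 2 * G + 1ℤ)) + + 2 * (G - 1ℤ))) ∎
  ρ-bounds L²≡ (inj₂ (refl , 2G≤L)) =
      Pos√5-norm<0 (subst (0ℤ <_) FG≡ 0<FG) (<-by-slack (0<-* {+ 4} 0<+suc 0<GG) ρ-norm)
    , Pos√5-norm>0 (subst (0ℤ <_) 2+2GL≡ (0<-+ {+ 2} 0<+suc (0≤-* {+ 2} (+≤+ z≤n) (ℤP.<⇒≤ 0<GL))))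
                     (<-by-slack (0<-* {+ 4} 0<+suc 0<1+s) half-norm)
    where
    0<GL : 0ℤ < G * L
    0<GL = 0<-* 0<G (ℤP.<-≤-trans (0<-* {+ 2} 0<+suc 0<G) 2G≤L)

    FG≡ : F * G ≡ - (-1ℤ * (F * G))
    FG≡ = solve (F ∷ G ∷ [])

    2+2GL≡ : + 2 + + 2 * (G * L) ≡ + 2 - + 2 * (-1ℤ * (G * L))
    2+2GL≡ = solve (G ∷ L ∷ [])

    0<1+s : 0ℤ < 1ℤ + + 2 * G * (L - + 2 * G)
    0<1+s = 0<-+ 0<+suc (0≤-* (0≤-* {+ 2} (+≤+ z≤n) (ℤP.<⇒≤ 0<G)) (ℤP.i≤j⇒0≤j-i 2G≤L))

    ρ-norm : + 5 * (- (-1ℤ * (F * G)) * - (-1ℤ * (F * G))) ≡ (-1ℤ * (G * L)) * (-1ℤ * (G * L)) + + 4 * (G * G)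
    ρ-norm = begin
      + 5 * (- (-1ℤ * (F * G)) * - (-1ℤ * (F * G)))     ≡⟨ solve (F ∷ G ∷ []) ⟩
      (G * G) * (+ 5 * (F * F) + + 4 * -1ℤ) + + 4 * (G * G) ≡⟨ cong (λ c → (G * G) * c + + 4 * (G * G)) L²≡ ⟨
      (G * G) * (L * L) + + 4 * (G * G)                 ≡⟨ solve (G ∷ L ∷ []) ⟩
      (-1ℤ * (G * L)) * (-1ℤ * (G * L)) + + 4 * (G * G) ∎

    half-norm : (+ 2 - + 2 * (-1ℤ * (G * L))) * (+ 2 - + 2 * (-1ℤ * (G * L)))
              ≡ + 5 * ((+ 2 * (-1ℤ * (F * G))) * (+ 2 * (-1ℤ * (F * G)))) + + 4 * (1ℤ + + 2 * G * (L - + 2 * G))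
    half-norm = begin
      (+ 2 - + 2 * (-1ℤ * (G * L))) * (+ 2 - + 2 * (-1ℤ * (G * L)))
        ≡⟨ solve (G ∷ L ∷ []) ⟩
      + 4 * (G * G) * (L * L) + + 16 * (G * G) + + 4 * (1ℤ + + 2 * G * (L - + 2 * G))
        ≡⟨ cong (λ c → + 4 * (G * G) * c + + 16 * (G * G) + + 4 * (1ℤ + + 2 * G * (L - + 2 * G))) L²≡ ⟩
      + 4 * (G * G) * (+ 5 * (F * F) + + 4 * -1ℤ) + + 16 * (G * G) + + 4 * (1ℤ + + 2 * G * (L - + 2 * G))
        ≡⟨ solve (F ∷ G ∷ L ∷ []) ⟩
      + 5 * ((+ 2 * (-1ℤ * (F * G))) * (+ 2 * (-1ℤ * (F * G)))) + + 4 * (1ℤ + + 2 * G * (L - + 2 * G)) ∎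

-- The lattice (ℤ + ℤφ)/F

∣∣-pos : ∀ z → T (isPos z) → ∣ z ∣φ ≡ z
∣∣-pos z pos with isPos z
... | true = refl
... | false = ⊥-elim pos

∣∣-nonpos : ∀ z → ¬ T (isPos z) → ∣ z ∣φ ≡ neg z
∣∣-nonpos z ¬pos with isPos z
... | true = ⊥-elim (¬pos _)
... | false = refl

-- The signs of lattice points (A + Bφ)/F are those of 2F (A + Bφ)/F = (2A + B) + B√5.

Nonneg : ℤ → ℤ → Set
Nonneg A B = Pos√5 (+ 2 ℤ.* A ℤ.+ B) B ⊎ (A ≡ 0ℤ × B ≡ 0ℤ)

-- 2 (A + Bφ)/F < 1/F
BelowHalfStep : ℤ → ℤ → Set
BelowHalfStep A B = Pos√5 (+ 2 ℤ.- + 2 ℤ.* (+ 2 ℤ.* A ℤ.+ B)) (ℤ.- (+ 2 ℤ.* B))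

module Lattice (F : ℕ) .{{_ : ℕ.NonZero F}} where

  u : ℚ
  u = + 1 / F

  instance
    u-pos : ℚ.Positive u
    u-pos = ℚP.normalize-pos 1 F

  point : ℤ → ℤ → Qφ
  point A B = (ι A ℚ.* u) + (ι B ℚ.* u) φ

  private
    ι*u-+ : ∀ i j → ι i ℚ.* u ℚ.+ ι j ℚ.* u ≡ ι (i ℤ.+ j) ℚ.* u
    ι*u-+ i j = trans (sym (ℚP.*-distribʳ-+ u (ι i) (ι j))) (cong (ℚ._* u) (sym (ι-+ i j)))

    ι*ι*u : ∀ i j → ι i ℚ.* (ι j ℚ.* u) ≡ ι (i ℤ.* j) ℚ.* u
    ι*ι*u i j = trans (sym (ℚP.*-assoc (ι i) (ι j) u)) (cong (ℚ._* u) (sym (ι-* i j)))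

  point-⊕ : ∀ A B C D → point A B ⊕ point C D ≡ point (A ℤ.+ C) (B ℤ.+ D)
  point-⊕ A B C D = cong₂ _+_φ (ι*u-+ A C) (ι*u-+ B D)

  neg-point : ∀ A B → neg (point A B) ≡ point (ℤ.- A) (ℤ.- B)
  neg-point A B = cong₂ _+_φ (neg-ι*u A) (neg-ι*u B)
    where
    neg-ι*u : ∀ i → ℚ.- (ι i ℚ.* u) ≡ ι (ℤ.- i) ℚ.* u
    neg-ι*u i = trans (ℚP.neg-distribˡ-* (ι i) u) (cong (ℚ._* u) (sym (ι-neg i)))

  point-⊖ : ∀ A B C D → point A B ⊖ point C D ≡ point (A ℤ.- C) (B ℤ.- D)
  point-⊖ A B C D = trans (cong (point A B ⊕_) (neg-point C D)) (point-⊕ A B (ℤ.- C) (ℤ.- D))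

  embed-/ : ∀ n → embed (n / F) ≡ point n 0ℤ
  embed-/ n = cong₂ _+_φ (/-ι n F) (sym (ℚP.*-zeroˡ u))

  ι-point : ∀ P Q → ι P + ι Q φ ≡ point (P ℤ.* + F) (Q ℤ.* + F)
  ι-point P Q = cong₂ _+_φ (ι≡ι*F*u P) (ι≡ι*F*u Q)
    where
    ι≡ι*F*u : ∀ i → ι i ≡ ι (i ℤ.* + F) ℚ.* u
    ι≡ι*F*u i = begin
      ι i                         ≡⟨ ℚP.*-identityʳ (ι i) ⟨
      ι i ℚ.* ℚ.1ℚ                ≡⟨ cong (ι i ℚ.*_) (ι*1/n≡1 F) ⟨
      ι i ℚ.* (ι (+ F) ℚ.* u)     ≡⟨ ι*ι*u i (+ F) ⟩
      ι (i ℤ.* + F) ℚ.* u         ∎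
      where open ≡-Reasoning

  ⊗-point : ∀ P Q C D → (ι P + ι Q φ) ⊗ point C D
                        ≡ point (P ℤ.* C ℤ.+ Q ℤ.* D) (P ℤ.* D ℤ.+ Q ℤ.* C ℤ.+ Q ℤ.* D)
  ⊗-point P Q C D = cong₂ _+_φ
    (trans (cong₂ ℚ._+_ (ι*ι*u P C) (ι*ι*u Q D)) (ι*u-+ (P ℤ.* C) (Q ℤ.* D)))
    (trans (cong₂ ℚ._+_ (trans (cong₂ ℚ._+_ (ι*ι*u P D) (ι*ι*u Q C)) (ι*u-+ (P ℤ.* D) (Q ℤ.* C))) (ι*ι*u Q D))
           (ι*u-+ (P ℤ.* D ℤ.+ Q ℤ.* C) (Q ℤ.* D)))

  isPos-point : ∀ A B → T (isPos (point A B)) ⇔ Pos√5 (+ 2 ℤ.* A ℤ.+ B) B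
  isPos-point A B = subst (λ x → T (isPos√5 x (ι B ℚ.* u)) ⇔ Pos√5 (+ 2 ℤ.* A ℤ.+ B) B)
    (sym (trans (cong (ℚ._+ ι B ℚ.* u) (ι*ι*u (+ 2) A)) (ι*u-+ (+ 2 ℤ.* A) B)))
    (isPos√5-scaled u)

  isPos-neg-point : ∀ A B → T (isPos (point A B)) → ¬ T (isPos (neg (point A B)))
  isPos-neg-point A B pos neg-pos = Pos√5-asym (isPos-point A B .to pos)
    (subst (λ x → Pos√5 x (ℤ.- B)) (coords A B)
      (isPos-point (ℤ.- A) (ℤ.- B) .to (subst (λ z → T (isPos z)) (neg-point A B) neg-pos)))
    where
    coords : ∀ A B → + 2 ℤ.* (ℤ.- A) ℤ.+ ℤ.- B ≡ ℤ.- (+ 2 ℤ.* A ℤ.+ B)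
    coords = solve-∀

  ∣±point∣ : ∀ {A B ε} → Nonneg A B → ε ≡ 1ℤ ⊎ ε ≡ -1ℤ →
             ∣ point (ε ℤ.* A) (ε ℤ.* B) ∣φ ≡ point A B
  ∣±point∣ {ε = ε} (inj₂ (refl , refl)) _ = begin
    ∣ point (ε ℤ.* 0ℤ) (ε ℤ.* 0ℤ) ∣φ  ≡⟨ cong ∣_∣φ (cong₂ point (ℤP.*-zeroʳ ε) (ℤP.*-zeroʳ ε)) ⟩
    ∣ point 0ℤ 0ℤ ∣φ                  ≡⟨ ∣∣-nonpos (point 0ℤ 0ℤ) (λ pos → ¬Pos√5-0 (isPos-point 0ℤ 0ℤ .to pos)) ⟩
    neg (point 0ℤ 0ℤ)                 ≡⟨ neg-point 0ℤ 0ℤ ⟩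
    point 0ℤ 0ℤ                       ∎
    where open ≡-Reasoning
  ∣±point∣ {A} {B} (inj₁ ρ>0) (inj₁ refl) = begin
    ∣ point (1ℤ ℤ.* A) (1ℤ ℤ.* B) ∣φ  ≡⟨ cong ∣_∣φ (cong₂ point (ℤP.*-identityˡ A) (ℤP.*-identityˡ B)) ⟩
    ∣ point A B ∣φ                    ≡⟨ ∣∣-pos (point A B) (isPos-point A B .from ρ>0) ⟩
    point A B                         ∎
    where open ≡-Reasoning
  ∣±point∣ {A} {B} (inj₁ ρ>0) (inj₂ refl) = begin
    ∣ point (-1ℤ ℤ.* A) (-1ℤ ℤ.* B) ∣φ  ≡⟨ cong ∣_∣φ (cong₂ point (ℤP.-1*i≡-i A) (ℤP.-1*i≡-i B)) ⟩
    ∣ point (ℤ.- A) (ℤ.- B) ∣φ          ≡⟨ cong ∣_∣φ (neg-point A B) ⟨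
    ∣ neg (point A B) ∣φ                ≡⟨ ∣∣-nonpos (neg (point A B)) (isPos-neg-point A B (isPos-point A B .from ρ>0)) ⟩
    neg (neg (point A B))               ≡⟨ cong neg (neg-point A B) ⟩
    neg (point (ℤ.- A) (ℤ.- B))         ≡⟨ neg-point (ℤ.- A) (ℤ.- B) ⟩
    point (ℤ.- ℤ.- A) (ℤ.- ℤ.- B)       ≡⟨ cong₂ point (ℤP.neg-involutive A) (ℤP.neg-involutive B) ⟩
    point A B                           ∎
    where open ≡-Reasoning

  private
    u+ερ>0 : ∀ {A B ε} → Nonneg A B → BelowHalfStep A B → ε ≡ 1ℤ ⊎ ε ≡ -1ℤ →
             Pos√5 (+ 2 ℤ.+ ε ℤ.* (+ 2 ℤ.* A ℤ.+ B)) (ε ℤ.* B)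
    u+ερ>0 (inj₂ (refl , refl)) _ (inj₁ refl) = Pos√5-2
    u+ερ>0 {A} {B} (inj₁ ρ>0) _ (inj₁ refl) =
      Pos√5-shift ρ>0 (+ 2) (+≤+ z≤n) (solve (A ∷ B ∷ [])) (solve (B ∷ []))
    u+ερ>0 {A} {B} _ u>2ρ (inj₂ refl) = Pos√5-cancel {+ 2} 0<+suc
      (Pos√5-shift u>2ρ (+ 2) (+≤+ z≤n) (solve (A ∷ B ∷ [])) (solve (B ∷ [])))

    u+ερ-ρ>0 : ∀ {A B ε} → BelowHalfStep A B → ε ≡ 1ℤ ⊎ ε ≡ -1ℤ →
               Pos√5 (+ 2 ℤ.+ (ε ℤ.- 1ℤ) ℤ.* (+ 2 ℤ.* A ℤ.+ B)) ((ε ℤ.- 1ℤ) ℤ.* B)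
    u+ερ-ρ>0 _ (inj₁ refl) = Pos√5-2
    u+ερ-ρ>0 {A} {B} u>2ρ (inj₂ refl) =
      Pos√5-shift u>2ρ 0ℤ (+≤+ z≤n) (solve (A ∷ B ∷ [])) (solve (B ∷ []))

  private
    1≤i⊎1≤-i : ∀ {i} → i ≢ 0ℤ → 1ℤ ℤ.≤ i ⊎ 1ℤ ℤ.≤ ℤ.- i
    1≤i⊎1≤-i {+ 0} i≢0 = ⊥-elim (i≢0 refl)
    1≤i⊎1≤-i {+ ℕ.suc n} _ = inj₁ (+≤+ (s≤s z≤n))
    1≤i⊎1≤-i { -[1+ n ]} _ = inj₂ (+≤+ (s≤s z≤n))

  -- J/F + ερ and J/F + ερ - ρ are at least 1/F + ερ and 1/F + (ε - 1)ρ, positive as 0 ≤ ρ < 1/(2F).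
  shifted-pos : ∀ {A B J ε} → Nonneg A B → BelowHalfStep A B → 1ℤ ℤ.≤ J → ε ≡ 1ℤ ⊎ ε ≡ -1ℤ →
                T (isPos (point (J ℤ.+ ε ℤ.* A) (ε ℤ.* B)))
              × T (isPos (point (J ℤ.+ ε ℤ.* A) (ε ℤ.* B) ⊖ point A B))
  shifted-pos {A} {B} {J} {ε} ρ≥0 u>2ρ 1≤J ε=±1 =
      isPos-point (J ℤ.+ ε ℤ.* A) (ε ℤ.* B) .from
        (Pos√5-shift (u+ερ>0 {A} {B} ρ≥0 u>2ρ ε=±1) (+ 2 ℤ.* (J ℤ.- 1ℤ)) 0≤2[J-1] (solve (A ∷ B ∷ J ∷ ε ∷ [])) refl)
    , subst (λ z → T (isPos z)) (sym (point-⊖ (J ℤ.+ ε ℤ.* A) (ε ℤ.* B) A B))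
        (isPos-point (J ℤ.+ ε ℤ.* A ℤ.- A) (ε ℤ.* B ℤ.- B) .from
          (Pos√5-shift (u+ερ-ρ>0 {A} {B} u>2ρ ε=±1) (+ 2 ℤ.* (J ℤ.- 1ℤ)) 0≤2[J-1]
                       (solve (A ∷ B ∷ J ∷ ε ∷ [])) (solve (B ∷ ε ∷ []))))
    where
    0≤2[J-1] : 0ℤ ℤ.≤ + 2 ℤ.* (J ℤ.- 1ℤ)
    0≤2[J-1] = 0≤-* {+ 2} (+≤+ z≤n) (ℤP.i≤j⇒0≤j-i 1≤J)

  point-<-∣shifted∣ : ∀ {A B J ε} → Nonneg A B → BelowHalfStep A B → J ≢ 0ℤ → ε ≡ 1ℤ ⊎ ε ≡ -1ℤ →
                      point A B <φ ∣ point (J ℤ.+ ε ℤ.* A) (ε ℤ.* B) ∣φ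
  point-<-∣shifted∣ {A} {B} {J} {ε} ρ≥0 u>2ρ J≢0 ε=±1 = by-sign (1≤i⊎1≤-i J≢0)
    where
    E : Qφ
    E = point (J ℤ.+ ε ℤ.* A) (ε ℤ.* B)

    -E≡ : neg E ≡ point (ℤ.- J ℤ.+ ℤ.- ε ℤ.* A) (ℤ.- ε ℤ.* B)
    -E≡ = trans (neg-point (J ℤ.+ ε ℤ.* A) (ε ℤ.* B))
               (cong₂ point (trans (ℤP.neg-distrib-+ J (ε ℤ.* A)) (cong (λ x → ℤ.- J ℤ.+ x) (ℤP.neg-distribˡ-* ε A)))
                            (ℤP.neg-distribˡ-* ε B))

    by-sign : 1ℤ ℤ.≤ J ⊎ 1ℤ ℤ.≤ ℤ.- J → point A B <φ ∣ E ∣φ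
    by-sign (inj₁ 1≤J) = subst (λ z → T (isPos (z ⊖ point A B))) (sym (∣∣-pos E (proj₁ E>0×E>ρ))) (proj₂ E>0×E>ρ)
      where
      E>0×E>ρ : T (isPos E) × T (isPos (E ⊖ point A B))
      E>0×E>ρ = shifted-pos {A} {B} {J} {ε} ρ≥0 u>2ρ 1≤J ε=±1
    by-sign (inj₂ 1≤-J) = subst (λ z → T (isPos (z ⊖ point A B))) (sym (trans (∣∣-nonpos E ¬E>0) -E≡)) (proj₂ -E>0×-E>ρ)
      where
      -E>0×-E>ρ : T (isPos (point (ℤ.- J ℤ.+ ℤ.- ε ℤ.* A) (ℤ.- ε ℤ.* B)))
                × T (isPos (point (ℤ.- J ℤ.+ ℤ.- ε ℤ.* A) (ℤ.- ε ℤ.* B) ⊖ point A B))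
      -E>0×-E>ρ = shifted-pos {A} {B} {ℤ.- J} {ℤ.- ε} ρ≥0 u>2ρ 1≤-J
                    (Sum.swap (Sum.map (cong (ℤ.-_)) (cong (ℤ.-_)) ε=±1))
      ¬E>0 : ¬ T (isPos E)
      ¬E>0 E>0 = isPos-neg-point (J ℤ.+ ε ℤ.* A) (ε ℤ.* B) E>0 (subst (λ z → T (isPos z)) (sym -E≡) (proj₁ -E>0×-E>ρ))

-- φ⁻ⁿ and the errors n/F - φ⁻ᵏ as lattice points

φ⁻¹-⊗ : ∀ p q → φ⁻¹ ⊗ (ι p + ι q φ) ≡ ι (q ℤ.- p) + ι p φ
φ⁻¹-⊗ p q = cong₂ _+_φ
  (begin
    ι -1ℤ ℚ.* ι p ℚ.+ ι 1ℤ ℚ.* ι q  ≡⟨ cong₂ ℚ._+_ (ι-* -1ℤ p) (ι-* 1ℤ q) ⟨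
    ι (-1ℤ ℤ.* p) ℚ.+ ι (1ℤ ℤ.* q)  ≡⟨ ι-+ (-1ℤ ℤ.* p) (1ℤ ℤ.* q) ⟨
    ι (-1ℤ ℤ.* p ℤ.+ 1ℤ ℤ.* q)      ≡⟨ cong ι coord₁ ⟩
    ι (q ℤ.- p)                     ∎)
  (begin
    ι -1ℤ ℚ.* ι q ℚ.+ ι 1ℤ ℚ.* ι p ℚ.+ ι 1ℤ ℚ.* ι q
      ≡⟨ cong₂ ℚ._+_ (cong₂ ℚ._+_ (ι-* -1ℤ q) (ι-* 1ℤ p)) (ι-* 1ℤ q) ⟨
    ι (-1ℤ ℤ.* q) ℚ.+ ι (1ℤ ℤ.* p) ℚ.+ ι (1ℤ ℤ.* q)
      ≡⟨ cong (ℚ._+ ι (1ℤ ℤ.* q)) (ι-+ (-1ℤ ℤ.* q) (1ℤ ℤ.* p)) ⟨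
    ι (-1ℤ ℤ.* q ℤ.+ 1ℤ ℤ.* p) ℚ.+ ι (1ℤ ℤ.* q)
      ≡⟨ ι-+ (-1ℤ ℤ.* q ℤ.+ 1ℤ ℤ.* p) (1ℤ ℤ.* q) ⟨
    ι (-1ℤ ℤ.* q ℤ.+ 1ℤ ℤ.* p ℤ.+ 1ℤ ℤ.* q)
      ≡⟨ cong ι coordφ ⟩
    ι p ∎)
  where
  open ≡-Reasoning
  coord₁ : -1ℤ ℤ.* p ℤ.+ 1ℤ ℤ.* q ≡ q ℤ.- p
  coord₁ = solve (p ∷ q ∷ [])
  coordφ : -1ℤ ℤ.* q ℤ.+ 1ℤ ℤ.* p ℤ.+ 1ℤ ℤ.* q ≡ p
  coordφ = solve (p ∷ q ∷ [])

φ^-≡ : ∀ n → φ^- n ≡ ι (sign n ℤ.* f (suc n)) + ι (ℤ.- (sign n ℤ.* f n)) φ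
φ^-≡ zero = refl
φ^-≡ (suc n) = begin
  φ⁻¹ ⊗ φ^- n
    ≡⟨ cong (φ⁻¹ ⊗_) (φ^-≡ n) ⟩
  φ⁻¹ ⊗ (ι (sign n ℤ.* f (suc n)) + ι (ℤ.- (sign n ℤ.* f n)) φ)
    ≡⟨ φ⁻¹-⊗ (sign n ℤ.* f (suc n)) (ℤ.- (sign n ℤ.* f n)) ⟩
  ι (ℤ.- (sign n ℤ.* f n) ℤ.- sign n ℤ.* f (suc n)) + ι (sign n ℤ.* f (suc n)) φ
    ≡⟨ cong₂ (λ x y → ι x + ι y φ) (coord₁ (sign n) (f (suc n)) (f n)) (coordφ (sign n) (f (suc n))) ⟩
  ι (sign (suc n) ℤ.* f (suc (suc n))) + ι (ℤ.- (sign (suc n) ℤ.* f (suc n))) φ ∎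
  where
  coord₁ : ∀ s x y → ℤ.- (s ℤ.* y) ℤ.- s ℤ.* x ≡ ℤ.- s ℤ.* (x ℤ.+ y)
  coord₁ = solve-∀
  coordφ : ∀ s x → s ℤ.* x ≡ ℤ.- (ℤ.- s ℤ.* x)
  coordφ = solve-∀
  open ≡-Reasoning

module _ where
  open import Data.Integer using (-_; _+_; _-_; _*_; _≤_; _<_)
  open ≡-Reasoning

  lucas-bound : ∀ {a b G} → G ≤ a + b → b ≤ a → + 2 * G ≤ (a + b) + + 2 * a
  lucas-bound {a} {b} {G} G≤F b≤a =
    ≤-by-slack {d = + 2 * (a + b - G) + (a - b)}
      (ℤP.+-mono-≤ (0≤-* {+ 2} (+≤+ ℕ.z≤n) (ℤP.i≤j⇒0≤j-i G≤F)) (ℤP.i≤j⇒0≤j-i b≤a))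
               (solve (a ∷ b ∷ G ∷ []))

  lucas-bound-strict : ∀ {a b G} → G ≤ a + b → b < a → + 2 * G + 1ℤ ≤ (a + b) + + 2 * a
  lucas-bound-strict {a} {b} {G} G≤F b<a =
    ≤-by-slack {d = + 2 * (a + b - G) + (a - (1ℤ + b))}
      (ℤP.+-mono-≤ (0≤-* {+ 2} (+≤+ ℕ.z≤n) (ℤP.i≤j⇒0≤j-i G≤F)) (ℤP.i≤j⇒0≤j-i (ℤP.i<j⇒suc[i]≤j b<a)))
               (solve (a ∷ b ∷ G ∷ []))

  ρ-bounds-lattice : ∀ {σ F a G} → 0ℤ < F → (F + + 2 * a) * (F + + 2 * a) ≡ + 5 * (F * F) + + 4 * σ →
             G ≡ 0ℤ ⊎ 0ℤ < G → (σ ≡ 1ℤ × + 2 * G + 1ℤ ≤ F + + 2 * a) ⊎ (σ ≡ -1ℤ × + 2 * G ≤ F + + 2 * a) →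
             Nonneg ((σ * (F + a)) * G) ((- (σ * F)) * G) × BelowHalfStep ((σ * (F + a)) * G) ((- (σ * F)) * G)
  ρ-bounds-lattice {σ} {F} {a} _ _ (inj₁ refl) _
    rewrite ℤP.*-zeroʳ (σ * (F + a)) | ℤP.*-zeroʳ (- (σ * F)) = inj₂ (refl , refl) , Pos√5-2
  ρ-bounds-lattice {σ} {F} {a} {G} 0<F L²≡ (inj₂ 0<G) L-bound =
      inj₁ (subst₂ Pos√5 (sym X≡) (sym Y≡) (proj₁ bounds))
    , subst₂ Pos√5 (cong (λ x → + 2 - + 2 * x) (sym X≡)) 2Y≡ (proj₂ bounds)
    where
    bounds : Pos√5 (σ * (G * (F + + 2 * a))) (- (σ * (F * G)))
           × Pos√5 (+ 2 - + 2 * (σ * (G * (F + + 2 * a)))) (+ 2 * (σ * (F * G)))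
    bounds = ρ-bounds {G} {F} {F + + 2 * a} 0<G 0<F {σ} L²≡ L-bound
    X≡ : + 2 * ((σ * (F + a)) * G) + (- (σ * F)) * G ≡ σ * (G * (F + + 2 * a))
    X≡ = solve (σ ∷ F ∷ a ∷ G ∷ [])
    Y≡ : (- (σ * F)) * G ≡ - (σ * (F * G))
    Y≡ = solve (σ ∷ F ∷ G ∷ [])
    2Y≡ : + 2 * (σ * (F * G)) ≡ - (+ 2 * ((- (σ * F)) * G))
    2Y≡ = solve (σ ∷ F ∷ G ∷ [])

  error-coord₁ : ∀ s σ t F G g h → s * s ≡ 1ℤ → σ * σ ≡ 1ℤ → F * g - h * G ≡ s * t → ∀ n →
                 n - (s * g) * F ≡ (n - t) + (- (s * σ)) * ((σ * h) * G)
  error-coord₁ s σ t F G g h s²≡1 σ²≡1 d'Ocagne n = sym (begin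
    (n - t) + (- (s * σ)) * ((σ * h) * G)       ≡⟨ solve (n ∷ t ∷ s ∷ σ ∷ h ∷ G ∷ []) ⟩
    n - (t + s * (h * G) * (σ * σ))             ≡⟨ cong (λ c → n - (t + s * (h * G) * c)) σ²≡1 ⟩
    n - (t + s * (h * G) * 1ℤ)                  ≡⟨ cong (λ c → n - (c + s * (h * G) * 1ℤ)) t≡ ⟩
    n - (s * (F * g - h * G) + s * (h * G) * 1ℤ) ≡⟨ solve (n ∷ s ∷ F ∷ g ∷ h ∷ G ∷ []) ⟩
    n - (s * g) * F                             ∎)
    where
    t≡ : t ≡ s * (F * g - h * G)
    t≡ = begin
      t             ≡⟨ ℤP.*-identityˡ t ⟨
      1ℤ * t        ≡⟨ cong (_* t) s²≡1 ⟨
      (s * s) * t   ≡⟨ ℤP.*-assoc s s t ⟩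
      s * (s * t)   ≡⟨ cong (s *_) d'Ocagne ⟨
      s * (F * g - h * G) ∎

  error-coordφ : ∀ s σ F G → σ * σ ≡ 1ℤ → 0ℤ - (- (s * G)) * F ≡ (- (s * σ)) * ((- (σ * F)) * G)
  error-coordφ s σ F G σ²≡1 = sym (begin
    (- (s * σ)) * ((- (σ * F)) * G)  ≡⟨ solve (s ∷ σ ∷ F ∷ G ∷ []) ⟩
    s * (F * G) * (σ * σ)            ≡⟨ cong (s * (F * G) *_) σ²≡1 ⟩
    s * (F * G) * 1ℤ                 ≡⟨ solve (s ∷ F ∷ G ∷ []) ⟩
    0ℤ - (- (s * G)) * F             ∎)

IsClosest : (m k t g N : ℕ) → Set
IsClosest m k t g N =
    ((n : ℤ) → n ≢ + t → ∣ embed ((+ t) /F^ m) ⊖ φ^- k ∣φ <φ ∣ embed (n /F^ m) ⊖ φ^- k ∣φ)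
  × ∣ embed ((+ t) /F^ m) ⊖ φ^- k ∣φ ≡ φ^- N ⊗ embed ((+ g) /F^ m)

module ClosestFraction (m k r : ℕ) (k+r≡N : k ℕ.+ r ≡ suc (suc m)) where
  open import Data.Integer using (-_; _+_; _-_; _*_; _≤_; _<_)
  open ≡-Reasoning
  open Lattice (fib (suc (suc m))) {{Fsup-nonZero m}}

  -- ρ = point A B is φ⁻ᴺ F_k / F, and the error at n is the lattice point (n - F_r)/F + ερ.
  ε : ℤ
  ε = - (sign k * sign (suc (suc m)))

  A B : ℤ
  A = (sign (suc (suc m)) * f (suc (suc (suc m)))) * f k
  B = (- (sign (suc (suc m)) * f (suc (suc m)))) * f k

  ε=±1 : ε ≡ 1ℤ ⊎ ε ≡ -1ℤ
  ε=±1 = subst (λ e → e ≡ 1ℤ ⊎ e ≡ -1ℤ) (cong (λ x → - x) (sign-+ k (suc (suc m))))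
               (sign-±1 (suc (k ℕ.+ suc (suc m))))

  ρ≡ : φ^- (suc (suc m)) ⊗ embed ((+ fib k) /F^ m) ≡ point A B
  ρ≡ = trans (cong₂ _⊗_ (φ^-≡ (suc (suc m))) (embed-/ (f k)))
             (trans (⊗-point P Q (f k) 0ℤ) (cong₂ point (coord₁ P Q (f k)) (coordφ P Q (f k))))
    where
    P Q : ℤ
    P = sign (suc (suc m)) * f (suc (suc (suc m)))
    Q = - (sign (suc (suc m)) * f (suc (suc m)))
    coord₁ : ∀ P Q G → P * G + Q * 0ℤ ≡ P * G
    coord₁ = solve-∀
    coordφ : ∀ P Q G → P * 0ℤ + Q * G + Q * 0ℤ ≡ Q * G
    coordφ = solve-∀

  error≡ : ∀ n → embed (n /F^ m) ⊖ φ^- k ≡ point ((n - f r) + ε * A) (ε * B)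
  error≡ n = begin
    embed (n /F^ m) ⊖ φ^- k
      ≡⟨ cong₂ _⊖_ (embed-/ n) (trans (φ^-≡ k) (ι-point (sign k * f (suc k)) (- (sign k * f k)))) ⟩
    point n 0ℤ ⊖ point ((sign k * f (suc k)) * f (suc (suc m))) ((- (sign k * f k)) * f (suc (suc m)))
      ≡⟨ point-⊖ n 0ℤ ((sign k * f (suc k)) * f (suc (suc m))) ((- (sign k * f k)) * f (suc (suc m))) ⟩
    point (n - (sign k * f (suc k)) * f (suc (suc m))) (0ℤ - (- (sign k * f k)) * f (suc (suc m)))
      ≡⟨ cong₂ point
           (error-coord₁ (sign k) (sign (suc (suc m))) (f r) (f (suc (suc m))) (f k) (f (suc k)) (f (suc (suc (suc m))))
                         (sign*sign k) (sign*sign (suc (suc m))) d'Ocagne-N n)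
           (error-coordφ (sign k) (sign (suc (suc m))) (f (suc (suc m))) (f k) (sign*sign (suc (suc m)))) ⟩
    point ((n - f r) + ε * A) (ε * B) ∎
    where
    d'Ocagne-N : f (suc (suc m)) * f (suc k) - f (suc (suc (suc m))) * f k ≡ sign k * f r
    d'Ocagne-N = subst (λ N → f N * f (suc k) - f (suc N) * f k ≡ sign k * f r) k+r≡N (d'Ocagne k r)

  0≤ρ<u/2 : Nonneg A B × BelowHalfStep A B
  0≤ρ<u/2 = ρ-bounds-lattice {sign (suc (suc m))} {f (suc (suc m))} {f (suc m)} {f k}
                 (+<+ (fib-suc-pos (suc m))) (lucas m) (G≡0⊎0<G k) L-bound
    where
    G≡0⊎0<G : ∀ k → f k ≡ 0ℤ ⊎ 0ℤ < f k
    G≡0⊎0<G zero = inj₁ refl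
    G≡0⊎0<G (suc k) = inj₂ (+<+ (fib-suc-pos k))

    G≤F : f k ≤ f (suc (suc m))
    G≤F = +≤+ (fib-mono (subst (k ℕ.≤_) k+r≡N (ℕP.m≤m+n k r)))

    L-bound : (sign (suc (suc m)) ≡ 1ℤ × + 2 * f k + 1ℤ ≤ f (suc (suc m)) + + 2 * f (suc m))
            ⊎ (sign (suc (suc m)) ≡ -1ℤ × + 2 * f k ≤ f (suc (suc m)) + + 2 * f (suc m))
    L-bound with sign-±1 m
    ... | inj₁ σ≡1 = inj₁ (trans (ℤP.neg-involutive (sign m)) σ≡1 ,
                           lucas-bound-strict {f (suc m)} {f m} {f k} G≤F (+<+ (fib-<-suc (sign≡1⇒≢1 {m} σ≡1))))
    ... | inj₂ σ≡-1 = inj₂ (trans (ℤP.neg-involutive (sign m)) σ≡-1 ,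
                            lucas-bound {f (suc m)} {f m} {f k} G≤F (+≤+ (fib-≤-suc m)))

  distance : ∣ embed ((+ fib r) /F^ m) ⊖ φ^- k ∣φ ≡ φ^- (suc (suc m)) ⊗ embed ((+ fib k) /F^ m)
  distance = begin
    ∣ embed ((+ fib r) /F^ m) ⊖ φ^- k ∣φ       ≡⟨ cong ∣_∣φ (error≡ (f r)) ⟩
    ∣ point ((f r - f r) + ε * A) (ε * B) ∣φ  ≡⟨ cong (λ x → ∣ point x (ε * B) ∣φ)
                                                    (trans (cong (_+ ε * A) (ℤP.+-inverseʳ (f r))) (ℤP.+-identityˡ (ε * A))) ⟩
    ∣ point (ε * A) (ε * B) ∣φ                ≡⟨ ∣±point∣ {A} {B} {ε} (proj₁ 0≤ρ<u/2) ε=±1 ⟩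
    point A B                                 ≡⟨ ρ≡ ⟨
    φ^- (suc (suc m)) ⊗ embed ((+ fib k) /F^ m) ∎

  nearest : ∀ n → n ≢ + fib r → ∣ embed ((+ fib r) /F^ m) ⊖ φ^- k ∣φ <φ ∣ embed (n /F^ m) ⊖ φ^- k ∣φ
  nearest n n≢t = subst₂ _<φ_ (sym (trans distance ρ≡)) (cong ∣_∣φ (sym (error≡ n)))
    (point-<-∣shifted∣ {A} {B} {n - f r} {ε} (proj₁ 0≤ρ<u/2) (proj₂ 0≤ρ<u/2)
                       (λ n-t≡0 → n≢t (ℤP.i-j≡0⇒i≡j n (f r) n-t≡0)) ε=±1)

  closest : IsClosest m k (fib r) (fib k) (suc (suc m))
  closest = nearest , distance

Fsup-diff : ∀ m k → k ℕ.≤ m ℕ.+ 2 → Fsup (+ m ℤ.- + k) ≡ fib (m ℕ.+ 2 ℕ.∸ k)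
Fsup-diff m k k≤m+2 = cong (λ i → fib ℤ.∣ i ∣) (begin
  (+ m ℤ.- + k) ℤ.+ + 2   ≡⟨ reassociate (+ m) (+ k) ⟩
  + (m ℕ.+ 2) ℤ.- + k     ≡⟨ ℤP.m-n≡m⊖n (m ℕ.+ 2) k ⟩
  (m ℕ.+ 2) ℤ.⊖ k         ≡⟨ ℤP.⊖-≥ k≤m+2 ⟩
  + (m ℕ.+ 2 ℕ.∸ k)       ∎)
  where
  reassociate : ∀ i j → (i ℤ.- j) ℤ.+ + 2 ≡ (i ℤ.+ + 2) ℤ.- j
  reassociate = solve-∀
  open ≡-Reasoning

Fsup-shift : ∀ k → Fsup (+ k ℤ.- + 2) ≡ fib k
Fsup-shift k = cong (λ i → fib ℤ.∣ i ∣) (cancel (+ k))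
  where
  cancel : ∀ i → (i ℤ.- + 2) ℤ.+ + 2 ≡ i
  cancel = solve-∀

open import Data.Nat using (_≤_; _+_)
open import Data.Integer using (_-_)

lemma5p1 : (m k : ℕ) → k ≤ m + 2 →
    ((n : ℤ) → n ≢ + Fsup (+ m - + k) →
      ∣ embed ((+ Fsup (+ m - + k)) /F^ m) ⊖ φ^- k ∣φ
        <φ ∣ embed (n /F^ m) ⊖ φ^- k ∣φ)
    × (∣ embed ((+ Fsup (+ m - + k)) /F^ m) ⊖ φ^- k ∣φ
        ≡ φ^- (m + 2) ⊗ embed ((+ Fsup (+ k - + 2)) /F^ m))
lemma5p1 m k k≤m+2 =
  subst₂ (λ t g → IsClosest m k t g (m + 2)) (sym (Fsup-diff m k k≤m+2)) (sym (Fsup-shift k))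
    (subst (IsClosest m k (fib (m + 2 ℕ.∸ k)) (fib k)) (ℕP.+-comm 2 m)
      (ClosestFraction.closest m k (m + 2 ℕ.∸ k) (trans (ℕP.m+[n∸m]≡n k≤m+2) (ℕP.+-comm m 2))))
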